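{- Let $\approx$ be an SCER on $\Sigma^*$, $T$ a string of length $n$, and $2\le i\le n$. Then $\mathsf{LongestLSeedCov}_T(i,j)=\mathsf{LongestLSeedCov}_T(i-1,j)$ for all $1\le j\le\mathit{Border}_T[i]$. Moreover, for $j=\mathit{Border}_T[i]$ (with $j\ge1$), if $T[:j]\notin\mathsf{LSeed}_{\approx}(T[:i-1])$, then $\mathsf{LongestLSeedCov}_T(i,j)=\mathsf{LongestLSeedCov}_T(i-1,\mathit{LCover}_T[j])$.
   Context: $\Sigma^*$ is the set of strings over an alphabet $\Sigma$. For a string $T$, $|T|$ is its length, $T[i:j]$ the substring from position $i$ to $j$, $T[:j]=T[1:j]$ ($T[:0]$ is empty), $T[i:]=T[i:|T|]$. An SCER is an equivalence relation $\approx$ on $\Sigma^*$ such that $X\approx Y$ implies $|X|=|Y|$ and $X[i:j]\approx Y[i:j]$ for all $1\le i\le j\le|X|$. $\mathsf{Occ}_{P,T}=\{\,i : 1\le i\le |T|-|P|+1,\ P\approx T[i:i+|P|-1]\,\}$. A string $B$ is a $\approx$-border of $T$ if $B\approx T[:|B|]\approx T[|T|-|B|+1:]$; proper if $|B|<|T|$. $\mathit{Border}_T[i]$ is the maximum length of a proper $\approx$-border of $T[:i]$ (the empty string counts). A string $C$ of length $c$ is a $\approx$-cover of $T$ of length $n$ if there are $x_1,\dots,x_m\in\mathsf{Occ}_{C,T}$ with $x_1=1$, $x_m=n-c+1$ and $x_{i-1}<x_i\le x_{i-1}+c$ for all $1<i\le m$; proper if $c<n$; $\mathsf{Cov}_\approx(T)$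 is the set of all $\approx$-covers of $T$. $\mathit{LCover}_T[i]=\max(\{\,|C| : C\text{ a proper }\approx\text{ -cover of }T[:i]\,\}\cup\{0\})$. A string $S$ of length $m$ is a left $\approx$-seed of a string $T$ of length $n$ if there exist non-negative integers $k,l$ with $k\le l<m$, $S\in\mathsf{Cov}_\approx(T[:n-k])$ and $S[:l]\approx T[n-l+1:]$ (here $S[:0]$ and $T[n+1:]$ are empty); $\mathsf{LSeed}_\approx(T)$ is their set. $\mathsf{LongestLSeedCov}_T(i,j)=\max(\{\,l : T[:l]\in\mathsf{LSeed}_\approx(T[:i])\cap\mathsf{Cov}_\approx(T[:j])\,\}\cup\{0\})$. -}

module Defs where

open import Level using (Level; _⊔_; suc)
open import Data.Nat using (ℕ; zero; _+_; _∸_; _≤_; _<_)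
open import Data.List using (List; length; take; drop)
open import Data.Product using (Σ; ∃; _×_; _,_)
open import Data.Sum using (_⊎_)
open import Relation.Binary.PropositionalEquality using (_≡_)
open import Relation.Binary.Structures using (IsEquivalence)

-- Strings over an alphabet A are lists; positions are 1-indexed as in the paper.
-- T[i:j] = take (j - i + 1) (drop (i - 1) T)   (for 1 ≤ i ≤ j ≤ |T|)
substr : ∀ {a} {A : Set a} → ℕ → ℕ → List A → List A
substr i j T = take (j ∸ i + 1) (drop (i ∸ 1) T)

IsMax : ∀ {p} → (ℕ → Set p) → ℕ → Set p
IsMax P m = P m × (∀ k → P k → k ≤ m)

record SCER {a} (A : Set a) (ℓ : Level) : Set (a ⊔ suc ℓ) where
  field
    _≈_     : List A → List A → Set ℓ
    isEquiv : IsEquivalence _≈_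
    ≈-len   : ∀ {X Y} → X ≈ Y → length X ≡ length Y
    ≈-sub   : ∀ {X Y} → X ≈ Y → ∀ i j → 1 ≤ i → i ≤ j → j ≤ length X →
              substr i j X ≈ substr i j Y

module _ {a ℓ} {A : Set a} (R : SCER A ℓ) where
  open SCER R

  Occ : List A → List A → ℕ → Set ℓ
  Occ P T i = (1 ≤ i) × (i + length P ≤ length T + 1) × (P ≈ take (length P) (drop (i ∸ 1) T))

  IsBorder : List A → List A → Set ℓ
  IsBorder B T = (B ≈ take (length B) T) × (B ≈ drop (length T ∸ length B) T)

  BorderArr : List A → ℕ → ℕ → Set (a ⊔ ℓ)
  BorderArr T i = IsMax (λ b → Σ (List A) λ B → length B ≡ b × b < i × IsBorder B (take i T))

  data Chain {p} (c : ℕ) (P : ℕ → Set p) : ℕ → ℕ → Set p where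
    stop : ∀ {x} → P x → Chain c P x x
    step : ∀ {x x' y} → P x → x < x' → x' ≤ x + c → Chain c P x' y → Chain c P x y

  Cover : List A → List A → Set ℓ
  Cover C T = Chain (length C) (Occ C T) 1 (length T ∸ length C + 1)

  LCoverArr : List A → ℕ → ℕ → Set (a ⊔ ℓ)
  LCoverArr T i = IsMax (λ v → (v ≡ 0) ⊎ (Σ (List A) λ C → length C ≡ v × v < i × Cover C (take i T)))

  LSeed : List A → List A → Set ℓ
  LSeed S T = ∃ λ k → ∃ λ l → k ≤ l × l < length S ×
                Cover S (take (length T ∸ k) T) × (take l S ≈ drop (length T ∸ l) T)

  -- LongestLSeedCov_T(i,j) = v   (l ranges over 0 ≤ l ≤ |T| so that T[:l] is defined)
  LongestLSeedCov : List A → ℕ → ℕ → ℕ → Set ℓ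
  LongestLSeedCov T i j = IsMax (λ l → (l ≡ 0) ⊎
      (l ≤ length T × LSeed (take l T) (take i T) × Cover (take l T) (take j T)))

module Submission where

-- Both identities compare the candidate sets {l ≥ 1 | T[:l] ∈ LSeed(T[:n]) ∩ Cov(T[:j])}.
-- A left seed T[:l] of T[:n+1] with l ≤ n is still a left seed of T[:n]: shorten its overhang
-- by one character or, if there is none, drop its last occurrence, whose part inside T[:n]
-- becomes the new overhang. Conversely, let T[:b] be a border of T[:n+1] and T[:l] a left seed
-- of T[:n] with l ≤ b. Restricted to T[:b] it is a left seed of T[:b], and the copy of that
-- seed at the suffix occurrence of T[:b] overlaps the cover of T[:n-k], so T[:l] is a left seed
-- of T[:n+1]. For j = b, a candidate for T[:i] cannot have length b, since T[:b] would then be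
-- a left seed of T[:i-1]; so it is a proper cover of T[:b], hence covers T[:LCover[b]], its
-- longest proper cover. Conversely, covers compose.

open import Defs
open import Data.Nat using (ℕ; zero; suc; _+_; _∸_; _⊓_; _≤_; _<_; z≤n; s≤s)
open import Data.Nat.Properties
open import Data.List using (List; length; take; drop)
open import Data.List.Properties using (length-take; take-take; take-drop; drop-drop)
open import Data.Product using (∃; ∃₂; _×_; _,_; proj₁; proj₂)
open import Data.Sum using (_⊎_; inj₁; inj₂)
open import Data.Empty using (⊥-elim)
open import Function using (id)
open import Relation.Nullary using (¬_; yes; no)
open import Relation.Binary.PropositionalEquality
  using (_≡_; refl; sym; trans; cong; cong₂; subst; subst₂; module ≡-Reasoning)
open import Relation.Binary.Structures using (IsEquivalence)

module _ {a} {A : Set a} where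

  length-take-≤ : ∀ {n} (xs : List A) → n ≤ length xs → length (take n xs) ≡ n
  length-take-≤ {n} xs n≤ = trans (length-take n xs) (m≤n⇒m⊓n≡m n≤)

  take-take-≤ : ∀ {m n} (xs : List A) → m ≤ n → take m (take n xs) ≡ take m xs
  take-take-≤ {m} {n} xs m≤n = trans (take-take m n xs) (cong (λ k → take k xs) (m≤n⇒m⊓n≡m m≤n))

  take-drop-take : ∀ {d m p} (xs : List A) → d + m ≤ p →
                   take m (drop d (take p xs)) ≡ take m (drop d xs)
  take-drop-take {d} {m} {p} xs d+m≤p = begin
    take m (drop d (take p xs))       ≡⟨ take-drop m d (take p xs) ⟩
    drop d (take (d + m) (take p xs)) ≡⟨ cong (drop d) (take-take-≤ xs d+m≤p) ⟩
    drop d (take (d + m) xs)          ≡⟨ take-drop m d xs ⟨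
    take m (drop d xs)                ∎
    where open ≡-Reasoning

  drop-take-suffix : ∀ {m n} (xs : List A) → m ≤ n →
                     drop (n ∸ m) (take n xs) ≡ take m (drop (n ∸ m) xs)
  drop-take-suffix {m} {n} xs m≤n = begin
    drop (n ∸ m) (take n xs)
      ≡⟨ cong (λ k → drop (n ∸ m) (take k xs)) (m+[n∸m]≡n (m∸n≤m n m)) ⟨
    drop (n ∸ m) (take (n ∸ m + (n ∸ (n ∸ m))) xs)
      ≡⟨ take-drop (n ∸ (n ∸ m)) (n ∸ m) xs ⟨
    take (n ∸ (n ∸ m)) (drop (n ∸ m) xs)
      ≡⟨ cong (λ k → take k (drop (n ∸ m) xs)) (m∸[m∸n]≡n m≤n) ⟩
    take m (drop (n ∸ m) xs)
      ∎
    where open ≡-Reasoning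

∸-telescope : ∀ {l m n} → l ≤ m → m ≤ n → (n ∸ m) + (m ∸ l) ≡ n ∸ l
∸-telescope {l} {m} {n} l≤m m≤n = trans (sym (+-∸-assoc (n ∸ m) l≤m)) (cong (_∸ l) (m∸n+n≡m m≤n))

module ChainProperties {a ℓ} {A : Set a} (R : SCER A ℓ) {p} {c : ℕ} {P : ℕ → Set p} where

  chain-≤ : ∀ {x y} → Chain R c P x y → x ≤ y
  chain-≤ (stop _) = ≤-refl
  chain-≤ (step _ x<x' _ rest) = ≤-trans (<⇒≤ x<x') (chain-≤ rest)

  chain-head : ∀ {x y} → Chain R c P x y → P x
  chain-head (stop px) = px
  chain-head (step px _ _ _) = px

  chain-last : ∀ {x y} → Chain R c P x y → P y
  chain-last (stop py) = py
  chain-last (step _ _ _ rest) = chain-last rest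

  chain-shift : ∀ {q} {Q : ℕ → Set q} d {x y} → (∀ {z} → z ≤ y → P z → Q (d + z)) →
                Chain R c P x y → Chain R c Q (d + x) (d + y)
  chain-shift d f (stop py) = stop (f ≤-refl py)
  chain-shift d f (step {x} px x<x' x'≤x+c rest) =
    step (f (≤-trans (<⇒≤ x<x') (chain-≤ rest)) px) (+-monoʳ-< d x<x')
         (≤-trans (+-monoʳ-≤ d x'≤x+c) (≤-reflexive (sym (+-assoc d x c))))
         (chain-shift d f rest)

  chain-map : ∀ {q} {Q : ℕ → Set q} {x y} → (∀ {z} → z ≤ y → P z → Q z) →
              Chain R c P x y → Chain R c Q x y
  chain-map f (stop py) = stop (f ≤-refl py)
  chain-map f (step px x<x' x'≤x+c rest) =
    step (f (≤-trans (<⇒≤ x<x') (chain-≤ rest)) px) x<x' x'≤x+c (chain-map f rest)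

  chain-merge : ∀ {x y x' z} → Chain R c P x y → Chain R c P x' z → x ≤ x' → x' ≤ y + c →
                Chain R c P x z
  chain-merge (stop px) second x≤x' x'≤y+c with m≤n⇒m<n∨m≡n x≤x'
  ... | inj₁ x<x' = step px x<x' x'≤y+c second
  ... | inj₂ refl = second
  chain-merge {x' = x'} (step {_} {u} px x<u u≤x+c rest) second x≤x' x'≤y+c with u ≤? x'
  ... | yes u≤x' = step px x<u u≤x+c (chain-merge rest second u≤x' x'≤y+c)
  ... | no u≰x' with m≤n⇒m<n∨m≡n x≤x'
  ...   | inj₁ x<x' = step px x<x' (≤-trans (<⇒≤ (≰⇒> u≰x')) u≤x+c) second
  ...   | inj₂ refl = second

  chain-init : ∀ {x y} → x < y → Chain R c P x y → ∃ λ q → q < y × y ≤ q + c × Chain R c P x q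
  chain-init x<y (stop _) = ⊥-elim (<-irrefl refl x<y)
  chain-init {x} {y} _ (step {_} {u} px x<u u≤x+c rest) with u <? y
  ... | yes u<y = let (q , q<y , y≤q+c , init) = chain-init u<y rest in
                  q , q<y , y≤q+c , step px x<u u≤x+c init
  ... | no u≮y with ≤-antisym (chain-≤ rest) (≮⇒≥ u≮y)
  ...   | refl = x , x<u , u≤x+c , stop px

  chain-cut : ∀ {x y t} → x ≤ t → t ≤ y → P t → Chain R c P x y → Chain R c P x t
  chain-cut x≤t t≤y pt (stop px) with ≤-antisym x≤t t≤y
  ... | refl = stop px
  chain-cut {t = t} x≤t t≤y pt (step {_} {u} px x<u u≤x+c rest) with u ≤? t
  ... | yes u≤t = step px x<u u≤x+c (chain-cut u≤t t≤y pt rest)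
  ... | no u≰t with m≤n⇒m<n∨m≡n x≤t
  ...   | inj₁ x<t = step px x<t (≤-trans (<⇒≤ (≰⇒> u≰t)) u≤x+c) (stop pt)
  ...   | inj₂ refl = stop px

  chain-pred : ∀ {x y} → Chain R c P (suc x) (suc y) → Chain R c (λ z → P (suc z)) x y
  chain-pred (stop py) = stop py
  chain-pred (step {x' = zero} _ () _ _)
  chain-pred (step {x' = suc _} px (s≤s x<u) (s≤s u≤x+c) rest) = step px x<u u≤x+c (chain-pred rest)

module CoverProperties {a ℓ} {A : Set a} (R : SCER A ℓ) where
  open SCER R
  open IsEquivalence isEquiv renaming (refl to ≈-refl; sym to ≈-sym; trans to ≈-trans)
  open ChainProperties R

  ≈-window : ∀ {X Y} w m → X ≈ Y → w + m ≤ length X → take m (drop w X) ≈ take m (drop w Y)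
  ≈-window w zero _ _ = ≈-refl
  ≈-window {X} {Y} w (suc m) X≈Y w+m≤X =
    subst₂ _≈_ (cong (λ k → take k (drop w X)) width) (cong (λ k → take k (drop w Y)) width)
      (≈-sub X≈Y (suc w) (w + suc m) (s≤s z≤n)
        (≤-trans (s≤s (m≤m+n w m)) (≤-reflexive (sym (+-suc w m)))) w+m≤X)
    where
    width : (w + suc m) ∸ suc w + 1 ≡ suc m
    width = trans (cong (λ k → k ∸ suc w + 1) (+-suc w m))
                  (trans (cong (_+ 1) (m+n∸m≡n w m)) (+-comm m 1))

  Cover-length : ∀ {C U} → Cover R C U → length C ≤ length U
  Cover-length {C} {U} cover with chain-head cover
  ... | _ , 1+C≤U+1 , _ = ≤-pred (subst (suc (length C) ≤_) (+-comm (length U) 1) 1+C≤U+1)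

  Cover-resp-≈ : ∀ {C C' U} → C ≈ C' → Cover R C U → Cover R C' U
  Cover-resp-≈ {C} {C'} {U} C≈C' cover =
    subst (λ m → Chain R m (Occ R C' U) 1 (length U ∸ m + 1)) (≈-len C≈C') (chain-map occ cover)
    where
    occ : ∀ {x} → x ≤ length U ∸ length C + 1 → Occ R C U x → Occ R C' U x
    occ {x} _ (1≤x , bound , C≈) =
      1≤x , subst (λ m → x + m ≤ length U + 1) (≈-len C≈C') bound ,
      ≈-trans (≈-sym C≈C') (subst (λ m → C ≈ take m (drop (x ∸ 1) U)) (≈-len C≈C') C≈)

  Cover-by-prefix : ∀ {C U} → Cover R C U → Cover R (take (length C) U) U
  Cover-by-prefix cover = Cover-resp-≈ (proj₂ (proj₂ (chain-head cover))) cover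

module PrefixCovers {a ℓ} {A : Set a} (R : SCER A ℓ) (T : List A) where
  open SCER R
  open IsEquivalence isEquiv using () renaming (sym to ≈-sym; trans to ≈-trans)
  open ChainProperties R
  open CoverProperties R

  N : ℕ
  N = length T

  -- Offsets are 0-based: Occurs l d is the paper's d + 1 ∈ Occ_{T[:l],T}. Covers needs l ≤ p
  -- explicitly because p ∸ l truncates.
  Occurs : ℕ → ℕ → Set ℓ
  Occurs l d = take l T ≈ take l (drop d T)

  Covers : ℕ → ℕ → Set ℓ
  Covers l p = l ≤ p × Chain R l (Occurs l) 0 (p ∸ l)

  LeftSeed : ℕ → ℕ → Set ℓ
  LeftSeed l n = ∃₂ λ k l' → k ≤ l' × l' < l × Covers l (n ∸ k) × Occurs l' (n ∸ l')

  occurs-window : ∀ {c d w m} → c ≤ N → Occurs c d → w + m ≤ c →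
                  take m (drop w T) ≈ take m (drop (d + w) T)
  occurs-window {c} {d} {w} {m} c≤N occ w+m≤c =
    subst₂ _≈_ (take-drop-take T w+m≤c)
      (trans (take-drop-take (drop d T) w+m≤c) (cong (take m) (drop-drop d w T)))
      (≈-window w m occ (subst (w + m ≤_) (sym (length-take-≤ T c≤N)) w+m≤c))

  occurs-prefix : ∀ {c m d} → m ≤ c → c ≤ N → Occurs c d → Occurs m d
  occurs-prefix {d = d} m≤c c≤N occ =
    subst (λ e → _ ≈ take _ (drop e T)) (+-identityʳ d) (occurs-window {d = d} c≤N occ m≤c)

  covers-at : ∀ {l q c z} → c ≤ N → q ≤ c → Occurs c z → Covers l q →
              Chain R l (Occurs l) z (z + (q ∸ l))
  covers-at {l} {q} {c} {z} c≤N q≤c occ (l≤q , chain) =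
    subst (λ s → Chain R l (Occurs l) s (z + (q ∸ l))) (+-identityʳ z)
      (chain-shift z transport chain)
    where
    transport : ∀ {w} → w ≤ q ∸ l → Occurs l w → Occurs l (z + w)
    transport {w} w≤q∸l occ-w = ≈-trans occ-w (occurs-window {d = z} c≤N occ w+l≤c)
      where
      w+l≤c : w + l ≤ c
      w+l≤c = ≤-trans (+-monoˡ-≤ l w≤q∸l) (≤-trans (≤-reflexive (m∸n+n≡m l≤q)) q≤c)

  covers-trans : ∀ {l c p} → c ≤ N → l ≤ c → Covers l c → Covers c p → Covers l p
  covers-trans {l} {c} {p} c≤N l≤c covers-c (c≤p , chain) =
    ≤-trans l≤c c≤p , subst (Chain R l (Occurs l) 0) (∸-telescope l≤c c≤p) (refine chain)
    where
    refine : ∀ {x y} → Chain R c (Occurs c) x y → Chain R l (Occurs l) x (y + (c ∸ l))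
    refine (stop occ) = covers-at c≤N ≤-refl occ covers-c
    refine {x} (step occ x<x' x'≤x+c rest) =
      chain-merge (covers-at c≤N ≤-refl occ covers-c) (refine rest) (<⇒≤ x<x')
        (≤-trans x'≤x+c (≤-reflexive (begin
          x + c              ≡⟨ cong (x +_) (m∸n+n≡m l≤c) ⟨
          x + ((c ∸ l) + l)  ≡⟨ +-assoc x (c ∸ l) l ⟨
          x + (c ∸ l) + l    ∎)))
      where open ≡-Reasoning

  covers-restrict : ∀ {l c b} → c ≤ N → l ≤ c → Covers l b → Covers c b → Covers l c
  covers-restrict {l} {c} {b} c≤N l≤c (_ , chain-l) (c≤b , chain-c) =
    l≤c , chain-cut z≤n (∸-monoˡ-≤ l c≤b) ends-c chain-l
    where
    -- T[:l] and T[:c] both end T[:b], so T[:l] also ends T[:c].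
    ends-c : Occurs l (c ∸ l)
    ends-c = ≈-trans (chain-last chain-l)
      (≈-sym (subst (λ s → take l (drop (c ∸ l) T) ≈ take l (drop s T)) (∸-telescope l≤c c≤b)
        (occurs-window {d = b ∸ c} c≤N (chain-last chain-c) (≤-reflexive (m∸n+n≡m l≤c)))))

  left-seed-shorten : ∀ {l n} → l ≤ n → suc n ≤ N → LeftSeed l (suc n) → LeftSeed l n
  left-seed-shorten {n = n} l≤n 1+n≤N (suc k , suc l' , s≤s k≤l' , 1+l'<l , covers , overhang) =
    k , l' , k≤l' , <-trans (n<1+n l') 1+l'<l , covers ,
    occurs-prefix {d = n ∸ l'} (n≤1+n l') (≤-trans (<⇒≤ 1+l'<l) (≤-trans l≤n (<⇒≤ 1+n≤N))) overhang
  left-seed-shorten {zero} _ _ (_ , _ , _ , () , _)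
  left-seed-shorten {suc l₀} {n} l≤n 1+n≤N (zero , _ , _ , _ , (_ , chain) , _)
    with chain-init (m<n⇒0<n∸m (s≤s l≤n)) chain
  ... | q , q<end , end≤q+l , init = n ∸ (q + l) , l₀ , n∸[q+l]≤l₀ , ≤-refl , covers , overhang
    where
    l : ℕ
    l = suc l₀
    q+l≤n : q + l ≤ n
    q+l≤n = ≤-pred (m≤o∸n⇒m+n≤o (suc q) (<⇒≤ (s≤s l≤n)) q<end)
    n∸[q+l]≤l₀ : n ∸ (q + l) ≤ l₀
    n∸[q+l]≤l₀ = m≤n+o⇒m∸n≤o n (q + l) (≤-pred (begin
      suc n                ≡⟨ m∸n+n≡m (<⇒≤ (s≤s l≤n)) ⟨
      (suc n ∸ l) + l      ≤⟨ +-monoˡ-≤ l end≤q+l ⟩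
      (q + l) + l          ≡⟨ +-suc (q + l) l₀ ⟩
      suc ((q + l) + l₀)   ∎))
      where open ≤-Reasoning
    covers : Covers l (n ∸ (n ∸ (q + l)))
    covers = subst (Covers l) (sym (m∸[m∸n]≡n q+l≤n))
               (m≤n+m l q , subst (Chain R l (Occurs l) 0) (sym (m+n∸n≡m q l)) init)
    overhang : Occurs l₀ (n ∸ l₀)
    overhang = occurs-prefix {d = n ∸ l₀} (n≤1+n l₀) (≤-trans l≤n (<⇒≤ 1+n≤N)) (chain-last chain)

  left-seed-restrict : ∀ {l m n} → l ≤ m → m ≤ n → n ≤ N → LeftSeed l n → LeftSeed l m
  left-seed-restrict {n = zero} _ z≤n _ seed = seed
  left-seed-restrict {n = suc n} l≤m m≤1+n 1+n≤N seed with m≤n⇒m<n∨m≡n m≤1+n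
  ... | inj₂ refl = seed
  ... | inj₁ (s≤s m≤n) =
    left-seed-restrict l≤m m≤n (<⇒≤ 1+n≤N) (left-seed-shorten (≤-trans l≤m m≤n) 1+n≤N seed)

  left-seed-extend : ∀ {l b n} → b ≤ n → suc n ≤ N → Occurs b (suc n ∸ b) → l ≤ b →
                     LeftSeed l n → LeftSeed l (suc n)
  left-seed-extend {l} {b} {n} b≤n 1+n≤N border l≤b seed@(k , _ , k≤l' , l'<l , (l≤n∸k , chain) , _)
    with left-seed-restrict l≤b b≤n (<⇒≤ 1+n≤N) seed
  ... | k₂ , l₂ , k₂≤l₂ , l₂<l , (l≤b∸k₂ , chain₂) , ends-b = k₂ , l₂ , k₂≤l₂ , l₂<l , covers , ends
    where
    d : ℕ
    d = suc n ∸ b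
    b≤N : b ≤ N
    b≤N = ≤-trans b≤n (<⇒≤ 1+n≤N)
    b≤1+n : b ≤ suc n
    b≤1+n = ≤-trans b≤n (n≤1+n n)
    k₂+l≤b : k₂ + l ≤ b
    k₂+l≤b = subst (_≤ b) (+-comm l k₂)
               (m≤o∸n⇒m+n≤o l (≤-trans k₂≤l₂ (≤-trans (<⇒≤ l₂<l) l≤b)) l≤b∸k₂)
    copy : Chain R l (Occurs l) d (d + (b ∸ k₂ ∸ l))
    copy = covers-at b≤N (m∸n≤m b k₂) border (l≤b∸k₂ , chain₂)
    reaches-copy : d ≤ (n ∸ k ∸ l) + l
    reaches-copy = begin
      suc n ∸ b          ≤⟨ ∸-monoʳ-≤ (suc n) (≤-trans (s≤s k≤l') (≤-trans l'<l l≤b)) ⟩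
      n ∸ k              ≡⟨ m∸n+n≡m l≤n∸k ⟨
      (n ∸ k ∸ l) + l    ∎
      where open ≤-Reasoning
    end : d + (b ∸ k₂ ∸ l) ≡ suc n ∸ k₂ ∸ l
    end = begin
      d + (b ∸ k₂ ∸ l)     ≡⟨ cong (d +_) (∸-+-assoc b k₂ l) ⟩
      d + (b ∸ (k₂ + l))   ≡⟨ ∸-telescope k₂+l≤b b≤1+n ⟩
      suc n ∸ (k₂ + l)     ≡⟨ ∸-+-assoc (suc n) k₂ l ⟨
      suc n ∸ k₂ ∸ l       ∎
      where open ≡-Reasoning
    covers : Covers l (suc n ∸ k₂)
    covers = m+n≤o⇒m≤o∸n l (subst (_≤ suc n) (+-comm k₂ l) (≤-trans k₂+l≤b b≤1+n)) ,
             subst (Chain R l (Occurs l) 0) end (chain-merge chain copy z≤n reaches-copy)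
    l₂≤b : l₂ ≤ b
    l₂≤b = ≤-trans (<⇒≤ l₂<l) l≤b
    ends : Occurs l₂ (suc n ∸ l₂)
    ends = subst (λ s → take l₂ T ≈ take l₂ (drop s T)) (∸-telescope l₂≤b b≤1+n)
             (≈-trans ends-b (occurs-window {d = d} b≤N border (≤-reflexive (m∸n+n≡m l₂≤b))))

  covering-prefix-≤ : ∀ {l j} → l ≤ N → Cover R (take l T) (take j T) → l ≤ j
  covering-prefix-≤ {l} {j} l≤N cover = begin
    l                  ≡⟨ length-take-≤ T l≤N ⟨
    length (take l T)  ≤⟨ Cover-length cover ⟩
    length (take j T)  ≡⟨ length-take j T ⟩
    j ⊓ N              ≤⟨ m⊓n≤m j N ⟩
    j                  ∎
    where open ≤-Reasoning

  Occ⇒occurs : ∀ {l p z} → l ≤ N → p ≤ N → Occ R (take l T) (take p T) (suc z) → Occurs l z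
  Occ⇒occurs {l} {p} {z} l≤N p≤N (_ , bound , rel)
    rewrite length-take-≤ T l≤N | length-take-≤ T p≤N =
    subst (take l T ≈_) (take-drop-take T (≤-pred (subst (suc (z + l) ≤_) (+-comm p 1) bound))) rel

  occurs⇒Occ : ∀ {l p z} → l ≤ N → p ≤ N → z + l ≤ p → Occurs l z →
               Occ R (take l T) (take p T) (suc z)
  occurs⇒Occ {l} {p} {z} l≤N p≤N z+l≤p occ
    rewrite length-take-≤ T l≤N | length-take-≤ T p≤N =
    s≤s z≤n , subst (suc (z + l) ≤_) (+-comm 1 p) (s≤s z+l≤p) ,
    subst (take l T ≈_) (sym (take-drop-take T z+l≤p)) occ

  Cover-take≡Chain : ∀ {l p} → l ≤ N → p ≤ N →
                     Cover R (take l T) (take p T) ≡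
                     Chain R l (Occ R (take l T) (take p T)) 1 (p ∸ l + 1)
  Cover-take≡Chain {l} {p} l≤N p≤N =
    cong₂ (λ c e → Chain R c (Occ R (take l T) (take p T)) 1 (e ∸ c + 1))
      (length-take-≤ T l≤N) (length-take-≤ T p≤N)

  Cover⇒covers : ∀ {l p} → l ≤ N → p ≤ N → Cover R (take l T) (take p T) → Covers l p
  Cover⇒covers {l} {p} l≤N p≤N cover =
    covering-prefix-≤ l≤N cover ,
    chain-map (λ _ → Occ⇒occurs l≤N p≤N)
      (chain-pred (subst (Chain R l (Occ R (take l T) (take p T)) 1) (+-comm (p ∸ l) 1)
        (subst id (Cover-take≡Chain l≤N p≤N) cover)))

  covers⇒Cover : ∀ {l p} → l ≤ N → p ≤ N → Covers l p → Cover R (take l T) (take p T)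
  covers⇒Cover {l} {p} l≤N p≤N (l≤p , chain) =
    subst id (sym (Cover-take≡Chain l≤N p≤N))
      (subst (Chain R l (Occ R (take l T) (take p T)) 1) (+-comm 1 (p ∸ l))
        (chain-shift 1 (λ z≤p∸l → occurs⇒Occ l≤N p≤N (m≤o∸n⇒m+n≤o _ l≤p z≤p∸l)) chain))

  prefix-of-prefix : ∀ {n} k → n ≤ N → take (length (take n T) ∸ k) (take n T) ≡ take (n ∸ k) T
  prefix-of-prefix {n} k n≤N =
    trans (cong (λ m → take (m ∸ k) (take n T)) (length-take-≤ T n≤N)) (take-take-≤ T (m∸n≤m n k))

  suffix-of-prefix : ∀ {m n} → m ≤ n → n ≤ N →
                     drop (length (take n T) ∸ m) (take n T) ≡ take m (drop (n ∸ m) T)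
  suffix-of-prefix {m} {n} m≤n n≤N =
    trans (cong (λ k → drop (k ∸ m) (take n T)) (length-take-≤ T n≤N)) (drop-take-suffix T m≤n)

  LSeed⇒left-seed : ∀ {l n} → l ≤ N → n ≤ N → LSeed R (take l T) (take n T) → LeftSeed l n
  LSeed⇒left-seed {l} {n} l≤N n≤N (k , l' , k≤l' , l'<|l| , cover , ends) =
    k , l' , k≤l' , l'<l , covers ,
    subst₂ _≈_ (take-take-≤ T (<⇒≤ l'<l)) (suffix-of-prefix l'≤n n≤N) ends
    where
    l'<l : l' < l
    l'<l = subst (l' <_) (length-take-≤ T l≤N) l'<|l|
    covers : Covers l (n ∸ k)
    covers = Cover⇒covers l≤N (≤-trans (m∸n≤m n k) n≤N)
               (subst (Cover R (take l T)) (prefix-of-prefix k n≤N) cover)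
    l'≤n : l' ≤ n
    l'≤n = ≤-trans (<⇒≤ l'<l) (≤-trans (proj₁ covers) (m∸n≤m n k))

  left-seed⇒LSeed : ∀ {l n} → l ≤ N → n ≤ N → LeftSeed l n → LSeed R (take l T) (take n T)
  left-seed⇒LSeed {l} {n} l≤N n≤N (k , l' , k≤l' , l'<l , covers , ends) =
    k , l' , k≤l' , subst (l' <_) (sym (length-take-≤ T l≤N)) l'<l ,
    subst (Cover R (take l T)) (sym (prefix-of-prefix k n≤N))
      (covers⇒Cover l≤N (≤-trans (m∸n≤m n k) n≤N) covers) ,
    subst₂ _≈_ (sym (take-take-≤ T (<⇒≤ l'<l))) (sym (suffix-of-prefix l'≤n n≤N)) ends
    where
    l'≤n : l' ≤ n
    l'≤n = ≤-trans (<⇒≤ l'<l) (≤-trans (proj₁ covers) (m∸n≤m n k))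

  IsBorder⇒occurs : ∀ {B b i} → length B ≡ b → b ≤ i → i ≤ N → IsBorder R B (take i T) →
                    Occurs b (i ∸ b)
  IsBorder⇒occurs refl b≤i i≤N (B≈prefix , B≈suffix) =
    ≈-trans (≈-sym (subst (_ ≈_) (take-take-≤ T b≤i) B≈prefix))
            (subst (_ ≈_) (suffix-of-prefix b≤i i≤N) B≈suffix)

  LCover-covers : ∀ {b c} → LCoverArr R T b c → 1 ≤ c → c < b × Cover R (take c T) (take b T)
  LCover-covers (inj₁ refl , _) ()
  LCover-covers {b} (inj₂ (C , refl , c<b , cover) , _) _ =
    c<b , subst (λ X → Cover R X (take b T)) (take-take-≤ T (<⇒≤ c<b)) (Cover-by-prefix cover)

  LSeed-shorten : ∀ {l n} → l ≤ n → suc n ≤ N →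
                  LSeed R (take l T) (take (suc n) T) → LSeed R (take l T) (take n T)
  LSeed-shorten {l} l≤n 1+n≤N seed =
    left-seed⇒LSeed l≤N (<⇒≤ 1+n≤N) (left-seed-shorten l≤n 1+n≤N (LSeed⇒left-seed l≤N 1+n≤N seed))
    where
    l≤N : l ≤ N
    l≤N = ≤-trans l≤n (<⇒≤ 1+n≤N)

  LSeed-extend : ∀ {l b n} → b ≤ n → suc n ≤ N → Occurs b (suc n ∸ b) → l ≤ b →
                 LSeed R (take l T) (take n T) → LSeed R (take l T) (take (suc n) T)
  LSeed-extend {l} b≤n 1+n≤N border l≤b seed =
    left-seed⇒LSeed l≤N 1+n≤N
      (left-seed-extend b≤n 1+n≤N border l≤b (LSeed⇒left-seed l≤N (<⇒≤ 1+n≤N) seed))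
    where
    l≤N : l ≤ N
    l≤N = ≤-trans l≤b (≤-trans b≤n (<⇒≤ 1+n≤N))

  Cover-trans : ∀ {l c p} → l ≤ c → c ≤ N → p ≤ N →
                Cover R (take l T) (take c T) → Cover R (take c T) (take p T) →
                Cover R (take l T) (take p T)
  Cover-trans {l} l≤c c≤N p≤N cover-c cover-p =
    covers⇒Cover l≤N p≤N
      (covers-trans c≤N l≤c (Cover⇒covers l≤N c≤N cover-c) (Cover⇒covers c≤N p≤N cover-p))
    where
    l≤N : l ≤ N
    l≤N = ≤-trans l≤c c≤N

  Cover-restrict : ∀ {l c b} → l ≤ c → c ≤ N → b ≤ N →
                   Cover R (take l T) (take b T) → Cover R (take c T) (take b T) →
                   Cover R (take l T) (take c T)
  Cover-restrict {l} l≤c c≤N b≤N cover-l cover-c =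
    covers⇒Cover l≤N c≤N
      (covers-restrict c≤N l≤c (Cover⇒covers l≤N b≤N cover-l) (Cover⇒covers c≤N b≤N cover-c))
    where
    l≤N : l ≤ N
    l≤N = ≤-trans l≤c c≤N

  LSeedCov-⊆ : ℕ → ℕ → ℕ → ℕ → Set ℓ
  LSeedCov-⊆ n j n' j' = ∀ {l} → 1 ≤ l → l ≤ N →
    LSeed R (take l T) (take n T) → Cover R (take l T) (take j T) →
    LSeed R (take l T) (take n' T) × Cover R (take l T) (take j' T)

  LongestLSeedCov-mono : ∀ {n j n' j' x y} → LSeedCov-⊆ n j n' j' →
    LongestLSeedCov R T n j x → LongestLSeedCov R T n' j' y → x ≤ y
  LongestLSeedCov-mono {n} {j} {n'} {j'} transfer (x-candidate , _) (_ , y-max) =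
    y-max _ (candidate x-candidate)
    where
    candidate : ∀ {l} →
      (l ≡ 0) ⊎ (l ≤ N × LSeed R (take l T) (take n T) × Cover R (take l T) (take j T)) →
      (l ≡ 0) ⊎ (l ≤ N × LSeed R (take l T) (take n' T) × Cover R (take l T) (take j' T))
    candidate (inj₁ l≡0) = inj₁ l≡0
    candidate {zero} (inj₂ _) = inj₁ refl
    candidate {suc _} (inj₂ (l≤N , seed , cover)) = inj₂ (l≤N , transfer (s≤s z≤n) l≤N seed cover)

lemma15 : ∀ {a ℓ} {A : Set a} (R : SCER A ℓ) (T : List A) (i : ℕ) →
    2 ≤ i → i ≤ length T →
    ∀ b → BorderArr R T i b →
    (∀ j → 1 ≤ j → j ≤ b → ∀ x y →
       LongestLSeedCov R T i j x → LongestLSeedCov R T (i ∸ 1) j y → x ≡ y)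
    × (1 ≤ b → ¬ LSeed R (take b T) (take (i ∸ 1) T) → ∀ c → LCoverArr R T b c →
       ∀ x y → LongestLSeedCov R T i b x → LongestLSeedCov R T (i ∸ 1) c y → x ≡ y)
lemma15 R T (suc i) _ 1+i≤N b ((B , |B|≡b , b<1+i , B-border) , _) =
  (λ j _ j≤b x y x-max y-max →
     ≤-antisym (LongestLSeedCov-mono (below-down j≤b) x-max y-max)
               (LongestLSeedCov-mono (below-up j≤b) y-max x-max)) ,
  λ _ b-not-seed c c-max x y x-max y-max →
     ≤-antisym (LongestLSeedCov-mono (border-down b-not-seed c-max) x-max y-max)
               (LongestLSeedCov-mono (border-up c-max) y-max x-max)
  where
  open PrefixCovers R T
  b≤i : b ≤ i
  b≤i = ≤-pred b<1+i
  b≤N : b ≤ N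
  b≤N = ≤-trans b≤i (<⇒≤ 1+i≤N)
  down : ∀ {l} → l ≤ i → LSeed R (take l T) (take (suc i) T) → LSeed R (take l T) (take i T)
  down l≤i = LSeed-shorten l≤i 1+i≤N
  up : ∀ {l} → l ≤ b → LSeed R (take l T) (take i T) → LSeed R (take l T) (take (suc i) T)
  up = LSeed-extend b≤i 1+i≤N (IsBorder⇒occurs |B|≡b (<⇒≤ b<1+i) 1+i≤N B-border)
  below-down : ∀ {j} → j ≤ b → LSeedCov-⊆ (suc i) j i j
  below-down j≤b _ l≤N seed cover =
    down (≤-trans (covering-prefix-≤ l≤N cover) (≤-trans j≤b b≤i)) seed , cover
  below-up : ∀ {j} → j ≤ b → LSeedCov-⊆ i j (suc i) j
  below-up j≤b _ l≤N seed cover = up (≤-trans (covering-prefix-≤ l≤N cover) j≤b) seed , cover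
  border-down : ∀ {c} → ¬ LSeed R (take b T) (take i T) → LCoverArr R T b c →
                LSeedCov-⊆ (suc i) b i c
  border-down b-not-seed c-max {l} 1≤l l≤N seed cover with m≤n⇒m<n∨m≡n (covering-prefix-≤ l≤N cover)
  ... | inj₂ refl = ⊥-elim (b-not-seed (down b≤i seed))
  ... | inj₁ l<b =
    let l≤c = proj₂ c-max l (inj₂ (take l T , length-take-≤ T l≤N , l<b , cover))
        (c<b , c-cover) = LCover-covers c-max (≤-trans 1≤l l≤c)
    in down (≤-trans (<⇒≤ l<b) b≤i) seed ,
       Cover-restrict {l} l≤c (≤-trans (<⇒≤ c<b) b≤N) b≤N cover c-cover
  border-up : ∀ {c} → LCoverArr R T b c → LSeedCov-⊆ i c (suc i) b
  border-up c-max 1≤l l≤N seed cover =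
    let l≤c = covering-prefix-≤ l≤N cover
        (c<b , c-cover) = LCover-covers c-max (≤-trans 1≤l l≤c)
    in up (≤-trans l≤c (<⇒≤ c<b)) seed , Cover-trans l≤c (≤-trans (<⇒≤ c<b) b≤N) b≤N cover c-cover
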